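{- There does not exist an $S(3,K_4^{(3)}+e,v)$ for $v=5$ or $v=6$.
   Context: $K_4^{(3)}+e$ denotes the 3-uniform hypergraph with vertex set $\{1,2,3,4,5\}$ and edge set $\{\{1,2,3\},\{1,2,4\},\{1,3,4\},\{2,3,4\},\{3,4,5\}\}$. An $S(3,K_4^{(3)}+e,v)$ is a partition of the set of all 3-subsets of a $v$-set into sub-hypergraphs each isomorphic to $K_4^{(3)}+e$ (a decomposition of $K_v^{(3)}$ into copies of $K_4^{(3)}+e$). -}

module Defs where

open import Data.Nat using (ℕ)
open import Data.Bool using (Bool)
import Data.Bool as B
open import Data.Fin using (Fin; #_)
open import Data.Fin.Subset using (Subset; ⁅_⁆; _∪_; ∣_∣)
open import Data.Vec.Properties using (≡-dec)
open import Data.List using (List; []; _∷_; concatMap; map; filter; length)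
open import Data.List.Relation.Unary.All using (All)
open import Data.Product using (Σ; _×_; _,_)
open import Function.Definitions using (Injective)
open import Relation.Binary.PropositionalEquality using (_≡_)
open import Relation.Binary.Definitions using (DecidableEquality)

_≟ₛ_ : ∀ {v} → DecidableEquality (Subset v)
_≟ₛ_ = ≡-dec B._≟_

-- The hypergraph K_4^(3)+e on vertex set Fin 5 (vertex i+1 of the paper is i here):
-- edges {1,2,3},{1,2,4},{1,3,4},{2,3,4},{3,4,5}.
K4+e-edges : List (Fin 5 × Fin 5 × Fin 5)
K4+e-edges =
  (# 0 , # 1 , # 2) ∷ (# 0 , # 1 , # 3) ∷ (# 0 , # 2 , # 3) ∷
  (# 1 , # 2 , # 3) ∷ (# 2 , # 3 , # 4) ∷ []

-- A copy of K_4^(3)+e in K_v^(3) is given by an injective vertex map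
-- f : Fin 5 → Fin v; its edges are the images of the edges above.
edgeImage : ∀ {v} → (Fin 5 → Fin v) → Fin 5 × Fin 5 × Fin 5 → Subset v
edgeImage f (i , j , k) = ⁅ f i ⁆ ∪ (⁅ f j ⁆ ∪ ⁅ f k ⁆)

allEdges : ∀ {v} → List (Fin 5 → Fin v) → List (Subset v)
allEdges B = concatMap (λ f → map (edgeImage f) K4+e-edges) B

multiplicity : ∀ {v} → List (Fin 5 → Fin v) → Subset v → ℕ
multiplicity B T = length (filter (_≟ₛ T) (allEdges B))

-- An S(3, K_4^(3)+e, v): a collection of copies of K_4^(3)+e in K_v^(3)
-- such that every 3-subset of the v-set lies in exactly one copy
-- (i.e. the edge sets of the copies partition the set of all 3-subsets).
S3K4e : ℕ → Set
S3K4e v =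
  Σ (List (Fin 5 → Fin v)) λ B →
    All (Injective _≡_ _≡_) B ×
    ((T : Subset v) → ∣ T ∣ ≡ 3 → multiplicity B T ≡ 1)

module Submission where

-- Forgetting the vertex maps, the edge sets of the copies form
-- an exact cover of the 3-subsets of the v-set by blocks taken from a finite
-- list of candidate blocks.
--
--  * Edge sets of copies: every edge of an injective copy is a 3-set, and
--    precomposing a copy with an automorphism of K₄⁽³⁾+e (swapping vertices
--    0,1 or 2,3) does not change its edge set, so every copy has the same
--    edges as a copy with f 0 ≤ f 1 and f 2 ≤ f 3.
--  * Exact covers, for an arbitrary type of items: a refutation tree (pick the
--    first uncovered item, branch over every candidate block containing it and
--    avoiding the covered items) is sound, i.e. its existence rules out every
--    exact cover by blocks equal as sets to candidates.
--  * For v = 5 and v = 6 the refutation tree over the 3-sets, with the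
--    oriented injective copies as candidates, is found by a decision procedure.

open import Defs
open import Data.Product using (_×_; ∃-syntax; _,_; proj₂)
open import Relation.Nullary using (¬_; Dec; yes; no; contradiction)
open import Data.Empty using (⊥)
open import Data.Nat using (ℕ; zero; suc; _+_; _≤_; z≤n; s≤s; _≟_)
open import Data.Nat.Properties using (+-commutativeSemigroup; +-mono-≤; m≤n+m; ≤-refl; ≤-antisym; module ≤-Reasoning)
open import Algebra.Properties.CommutativeSemigroup +-commutativeSemigroup using (x∙yz≈y∙xz)
open import Data.Fin using (Fin; zero; suc; #_) renaming (_≤_ to _≤ᶠ_; _≤?_ to _≤ᶠ?_)
open import Data.Fin.Properties using () renaming (_≟_ to _≟ᶠ_; ≤-total to ≤ᶠ-total; all? to allFin?)
open import Data.Fin.Subset using (Subset; ⁅_⁆; _∪_; ∣_∣; inside; outside)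
import Data.Fin.Subset as Subset
open import Data.Fin.Subset.Properties using (∣⁅x⁆∣≡1; x∈p∪q⁻; x∈⁅y⁆⇒x≡y; ∪-identityˡ; ∪-assoc; ∪-comm)
open import Data.List using (List; []; _∷_; _++_; map; concat; concatMap; filter; length; allFin; cartesianProductWith)
open import Data.List.Properties using (map-cong; concat-++; filter-++; length-++)
open import Data.List.Membership.Propositional using (_∈_; _∉_)
open import Data.List.Membership.Propositional.Properties
  using (∈-map⁺; ∈-map⁻; ∈-++⁺ˡ; ∈-++⁺ʳ; ∈-++⁻; ∈-∃++; ∈-concat⁺′; ∈-concat⁻′; ∈-filter⁺; ∈-filter⁻; ∈-allFin; ∈-cartesianProductWith⁺)
open import Data.List.Relation.Binary.Subset.Propositional using (_⊆_)
open import Data.List.Relation.Binary.Subset.Propositional.Properties using (⊆-trans)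
open import Data.List.Relation.Unary.Any using (Any; here; there)
import Data.List.Relation.Unary.Any as Any
open import Data.List.Relation.Unary.Any.Properties using (map⁺)
open import Data.List.Relation.Unary.All using (All; all?; _∷_; [])
import Data.List.Relation.Unary.All as All
import Data.Vec as Vec
open import Data.Vec using (Vec; lookup; tabulate) renaming ([] to []ᵥ; _∷_ to _∷ᵥ_)
open import Data.Vec.Properties using (lookup∘tabulate)
open import Data.Sum using (inj₁; inj₂)
open import Function using (_∘_)
open import Function.Definitions using (Injective)
open import Relation.Nullary.Decidable using (_×-dec_; _→-dec_; from-yes)
open import Relation.Binary.PropositionalEquality using (_≡_; _≢_; refl; sym; trans; cong; cong₂; subst; module ≡-Reasoning)
open import Relation.Binary.Definitions using (DecidableEquality)
open import Relation.Unary using (Decidable)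

∣⁅x⁆∪p∣≡1+∣p∣ : ∀ {n} (x : Fin n) (p : Subset n) → x Subset.∉ p → ∣ ⁅ x ⁆ ∪ p ∣ ≡ suc ∣ p ∣
∣⁅x⁆∪p∣≡1+∣p∣ zero    (outside ∷ᵥ p) x∉p = cong (suc ∘ ∣_∣) (∪-identityˡ p)
∣⁅x⁆∪p∣≡1+∣p∣ zero    (inside  ∷ᵥ p) x∉p = contradiction Vec.here x∉p
∣⁅x⁆∪p∣≡1+∣p∣ (suc x) (outside ∷ᵥ p) x∉p = ∣⁅x⁆∪p∣≡1+∣p∣ x p (x∉p ∘ Vec.there)
∣⁅x⁆∪p∣≡1+∣p∣ (suc x) (inside  ∷ᵥ p) x∉p = cong suc (∣⁅x⁆∪p∣≡1+∣p∣ x p (x∉p ∘ Vec.there))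

∉-pair : ∀ {n} {a b c : Fin n} → a ≢ b → a ≢ c → a Subset.∉ ⁅ b ⁆ ∪ ⁅ c ⁆
∉-pair {b = b} {c} a≢b a≢c a∈ with x∈p∪q⁻ ⁅ b ⁆ ⁅ c ⁆ a∈
... | inj₁ a∈b = a≢b (x∈⁅y⁆⇒x≡y b a∈b)
... | inj₂ a∈c = a≢c (x∈⁅y⁆⇒x≡y c a∈c)

triple-size : ∀ {n} {a b c : Fin n} → a ≢ b → a ≢ c → b ≢ c → ∣ ⁅ a ⁆ ∪ (⁅ b ⁆ ∪ ⁅ c ⁆) ∣ ≡ 3
triple-size {a = a} {b} {c} a≢b a≢c b≢c = begin
  ∣ ⁅ a ⁆ ∪ (⁅ b ⁆ ∪ ⁅ c ⁆) ∣ ≡⟨ ∣⁅x⁆∪p∣≡1+∣p∣ a _ (∉-pair a≢b a≢c) ⟩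
  suc ∣ ⁅ b ⁆ ∪ ⁅ c ⁆ ∣       ≡⟨ cong suc (∣⁅x⁆∪p∣≡1+∣p∣ b ⁅ c ⁆ (b≢c ∘ x∈⁅y⁆⇒x≡y c)) ⟩
  suc (suc ∣ ⁅ c ⁆ ∣)         ≡⟨ cong (2 +_) (∣⁅x⁆∣≡1 c) ⟩
  3                           ∎
  where open ≡-Reasoning

Copy : ℕ → Set
Copy v = Fin 5 → Fin v

PatternEdge : Set
PatternEdge = Fin 5 × Fin 5 × Fin 5

Edges : ∀ {v} → Copy v → List (Subset v)
Edges f = map (edgeImage f) K4+e-edges

pattern-edges-proper : All (λ { (i , j , k) → i ≢ j × i ≢ k × j ≢ k }) K4+e-edges
pattern-edges-proper =
  ((λ ()) , (λ ()) , (λ ())) ∷ ((λ ()) , (λ ()) , (λ ())) ∷ ((λ ()) , (λ ()) , (λ ())) ∷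
  ((λ ()) , (λ ()) , (λ ())) ∷ ((λ ()) , (λ ()) , (λ ())) ∷ []

copy-edge-size : ∀ {v} {f : Copy v} → Injective _≡_ _≡_ f → ∀ {e} → e ∈ Edges f → ∣ e ∣ ≡ 3
copy-edge-size {f = f} inj e∈ with ∈-map⁻ (edgeImage f) e∈
... | (i , j , k) , ijk∈ , refl with All.lookup pattern-edges-proper ijk∈
...   | i≢j , i≢k , j≢k = triple-size (i≢j ∘ inj) (i≢k ∘ inj) (j≢k ∘ inj)

Edges-cong : ∀ {v} {f g : Copy v} → (∀ i → f i ≡ g i) → Edges f ≡ Edges g
Edges-cong f≗g = map-cong (λ { (i , j , k) →
  cong₂ _∪_ (cong ⁅_⁆ (f≗g i)) (cong₂ _∪_ (cong ⁅_⁆ (f≗g j)) (cong ⁅_⁆ (f≗g k))) }) K4+e-edges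

span-swap₁₂ : ∀ {v} (a b c : Fin v) → ⁅ a ⁆ ∪ (⁅ b ⁆ ∪ ⁅ c ⁆) ≡ ⁅ b ⁆ ∪ (⁅ a ⁆ ∪ ⁅ c ⁆)
span-swap₁₂ a b c = begin
  ⁅ a ⁆ ∪ (⁅ b ⁆ ∪ ⁅ c ⁆) ≡⟨ ∪-assoc ⁅ a ⁆ ⁅ b ⁆ ⁅ c ⁆ ⟨
  (⁅ a ⁆ ∪ ⁅ b ⁆) ∪ ⁅ c ⁆ ≡⟨ cong (_∪ ⁅ c ⁆) (∪-comm ⁅ a ⁆ ⁅ b ⁆) ⟩
  (⁅ b ⁆ ∪ ⁅ a ⁆) ∪ ⁅ c ⁆ ≡⟨ ∪-assoc ⁅ b ⁆ ⁅ a ⁆ ⁅ c ⁆ ⟩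
  ⁅ b ⁆ ∪ (⁅ a ⁆ ∪ ⁅ c ⁆) ∎
  where open ≡-Reasoning

span-swap₂₃ : ∀ {v} (a b c : Fin v) → ⁅ a ⁆ ∪ (⁅ b ⁆ ∪ ⁅ c ⁆) ≡ ⁅ a ⁆ ∪ (⁅ c ⁆ ∪ ⁅ b ⁆)
span-swap₂₃ a b c = cong (⁅ a ⁆ ∪_) (∪-comm ⁅ b ⁆ ⁅ c ⁆)

_≈ₑ_ : ∀ {v} → Copy v → Copy v → Set
f ≈ₑ g = Edges f ⊆ Edges g × Edges g ⊆ Edges f

≈ₑ-trans : ∀ {v} {f g h : Copy v} → f ≈ₑ g → g ≈ₑ h → f ≈ₑ h
≈ₑ-trans (f⊆g , g⊆f) (g⊆h , h⊆g) = ⊆-trans f⊆g g⊆h , ⊆-trans h⊆g g⊆f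

SameTriple : PatternEdge → PatternEdge → Set
SameTriple e e′ = ∀ {v} (f : Copy v) → edgeImage f e ≡ edgeImage f e′

record Symmetry (σ : Fin 5 → Fin 5) : Set where
  field
    involutive : ∀ i → σ (σ i) ≡ i
    maps-edges : All (λ { (i , j , k) → Any (SameTriple (σ i , σ j , σ k)) K4+e-edges }) K4+e-edges

relabel : ∀ {v} {σ} → Symmetry σ → (f : Copy v) → Injective _≡_ _≡_ f →
          Injective _≡_ _≡_ (f ∘ σ) × (f ∘ σ) ≈ₑ f
relabel {v} {σ} sym-σ f inj = σ-injective ∘ inj , edges-⊆ f , edges-⊇
  where
  open Symmetry sym-σ

  σ-injective : ∀ {i j} → σ i ≡ σ j → i ≡ j
  σ-injective {i} {j} σi≡σj = trans (sym (involutive i)) (trans (cong σ σi≡σj) (involutive j))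

  edges-⊆ : (g : Copy v) → Edges (g ∘ σ) ⊆ Edges g
  edges-⊆ g e∈ with ∈-map⁻ (edgeImage (g ∘ σ)) e∈
  ... | (i , j , k) , ijk∈ , refl = map⁺ (Any.map (λ same → same g) (All.lookup maps-edges ijk∈))

  edges-⊇ : Edges f ⊆ Edges (f ∘ σ)
  edges-⊇ = subst (_⊆ Edges (f ∘ σ)) (Edges-cong (cong f ∘ involutive)) (edges-⊆ (f ∘ σ))

-- The automorphisms of K₄⁽³⁾+e are generated by the transposition (0 1) of
-- the K₄⁽³⁾-vertices off the pendant edge and the transposition (2 3) of
-- those on it.
swap₀₁ : Fin 5 → Fin 5
swap₀₁ zero = # 1
swap₀₁ (suc zero) = # 0
swap₀₁ i = i

swap₂₃ : Fin 5 → Fin 5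
swap₂₃ (suc (suc zero)) = # 3
swap₂₃ (suc (suc (suc zero))) = # 2
swap₂₃ i = i

swap₀₁-symmetry : Symmetry swap₀₁
swap₀₁-symmetry = record
  { involutive = λ { zero → refl ; (suc zero) → refl ; (suc (suc zero)) → refl
                   ; (suc (suc (suc zero))) → refl ; (suc (suc (suc (suc zero)))) → refl }
  ; maps-edges =
      here (λ _ → span-swap₁₂ _ _ _) ∷                       -- 012 ↦ 102
      there (here (λ _ → span-swap₁₂ _ _ _)) ∷               -- 013 ↦ 103
      there (there (there (here (λ _ → refl)))) ∷            -- 023 ↦ 123
      there (there (here (λ _ → refl))) ∷                    -- 123 ↦ 023
      there (there (there (there (here (λ _ → refl))))) ∷ [] -- 234 ↦ 234
  }

swap₂₃-symmetry : Symmetry swap₂₃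
swap₂₃-symmetry = record
  { involutive = λ { zero → refl ; (suc zero) → refl ; (suc (suc zero)) → refl
                   ; (suc (suc (suc zero))) → refl ; (suc (suc (suc (suc zero)))) → refl }
  ; maps-edges =
      there (here (λ _ → refl)) ∷                                           -- 012 ↦ 013
      here (λ _ → refl) ∷                                                   -- 013 ↦ 012
      there (there (here (λ _ → span-swap₂₃ _ _ _))) ∷                      -- 023 ↦ 032
      there (there (there (here (λ _ → span-swap₂₃ _ _ _)))) ∷              -- 123 ↦ 132
      there (there (there (there (here (λ _ → span-swap₁₂ _ _ _))))) ∷ []   -- 234 ↦ 324
  }

Oriented : ∀ {v} → Copy v → Set
Oriented f = f (# 0) ≤ᶠ f (# 1) × f (# 2) ≤ᶠ f (# 3)

orient : ∀ {v} (f : Copy v) → Injective _≡_ _≡_ f →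
         ∃[ g ] Injective _≡_ _≡_ g × Oriented g × g ≈ₑ f
orient f inj with ≤ᶠ-total (f (# 0)) (f (# 1)) | ≤ᶠ-total (f (# 2)) (f (# 3))
... | inj₁ f₀≤f₁ | inj₁ f₂≤f₃ = f , inj , (f₀≤f₁ , f₂≤f₃) , ((λ e∈ → e∈) , (λ e∈ → e∈))
... | inj₂ f₁≤f₀ | inj₁ f₂≤f₃ =
  let inj′ , same = relabel swap₀₁-symmetry f inj in f ∘ swap₀₁ , inj′ , (f₁≤f₀ , f₂≤f₃) , same
... | inj₁ f₀≤f₁ | inj₂ f₃≤f₂ =
  let inj′ , same = relabel swap₂₃-symmetry f inj in f ∘ swap₂₃ , inj′ , (f₀≤f₁ , f₃≤f₂) , same
... | inj₂ f₁≤f₀ | inj₂ f₃≤f₂ =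
  let inj′ , same′ = relabel swap₀₁-symmetry f inj
      inj″ , same″ = relabel swap₂₃-symmetry (f ∘ swap₀₁) inj′
  in f ∘ swap₀₁ ∘ swap₂₃ , inj″ , (f₁≤f₀ , f₃≤f₂) , ≈ₑ-trans {f = f ∘ swap₀₁ ∘ swap₂₃} {g = f ∘ swap₀₁} {h = f} same″ same′

-- Items of type A are to be covered by blocks, each block equal (as a set)
-- to one of the given candidates.
module ExactCover {A : Set} (_≟ₐ_ : DecidableEquality A)
                  (items : List A) (candidates : List (List A)) where

  open import Data.List.Membership.DecPropositional _≟ₐ_ using (_∈?_; _∉?_)

  count : A → List A → ℕ
  count x xs = length (filter (_≟ₐ x) xs)

  count-++ : ∀ x xs ys → count x (xs ++ ys) ≡ count x xs + count x ys
  count-++ x xs ys = trans (cong length (filter-++ (_≟ₐ x) xs ys)) (length-++ (filter (_≟ₐ x) xs))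

  ∈⇒count-pos : ∀ {x} xs → x ∈ xs → 1 ≤ count x xs
  ∈⇒count-pos {x} (y ∷ ys) x∈ with y ≟ₐ x | x∈
  ... | yes _   | _          = s≤s z≤n
  ... | no  y≢x | here x≡y   = contradiction (sym x≡y) y≢x
  ... | no  _   | there x∈ys = ∈⇒count-pos ys x∈ys

  count-pos⇒∈ : ∀ {x} xs → 1 ≤ count x xs → x ∈ xs
  count-pos⇒∈ {x} (y ∷ ys) pos with y ≟ₐ x
  ... | yes refl = here refl
  ... | no  _    = there (count-pos⇒∈ ys pos)

  Fits : List A → A → List A → Set
  Fits U T c = T ∈ c × All (_∉ U) c

  fits? : ∀ U T → Decidable (Fits U T)
  fits? U T c = (T ∈? c) ×-dec all? (_∉? U) c

  -- A refutation tree of depth n for the covered items U: every way of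
  -- covering the first uncovered item leads to a refutation of depth n − 1.
  mutual
    Refuted : ℕ → List A → Set
    Refuted zero    U = ⊥
    Refuted (suc n) U = RefutedAt n U (filter (_∉? U) items)

    RefutedAt : ℕ → List A → List A → Set
    RefutedAt n U []      = ⊥
    RefutedAt n U (T ∷ _) = All (λ c → Refuted n (c ++ U)) (filter (fits? U T) candidates)

  mutual
    refuted? : ∀ n U → Dec (Refuted n U)
    refuted? zero    U = no λ ()
    refuted? (suc n) U = refutedAt? n U (filter (_∉? U) items)

    refutedAt? : ∀ n U Ts → Dec (RefutedAt n U Ts)
    refutedAt? n U []      = no λ ()
    refutedAt? n U (T ∷ _) = all? (λ c → refuted? n (c ++ U)) (filter (fits? U T) candidates)

  record Partial (U : List A) (Bs : List (List A)) : Set where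
    field
      covers : ∀ {x} → x ∈ items → x ∉ U → x ∈ concat Bs
      fresh  : ∀ {x} → x ∈ U → x ∉ concat Bs
      once   : ∀ {x} → x ∈ concat Bs → count x (concat Bs) ≡ 1
      known  : ∀ {b} → b ∈ Bs → ∃[ c ] c ∈ candidates × b ⊆ c × c ⊆ b

  place : ∀ {U} xs b ys {c} → Partial U (xs ++ b ∷ ys) → b ⊆ c → c ⊆ b →
          Partial (c ++ U) (xs ++ ys)
  place {U} xs b ys {c} P b⊆c c⊆b = record
    { covers = covers′ ; fresh = fresh′ ; once = once′ ; known = known ∘ widenᴮ }
    where
    open Partial P
    X = concat xs
    Y = concat ys

    split : concat (xs ++ b ∷ ys) ≡ X ++ (b ++ Y)
    split = sym (concat-++ xs (b ∷ ys))

    merge : concat (xs ++ ys) ≡ X ++ Y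
    merge = sym (concat-++ xs ys)

    widenᴮ : ∀ {b′} → b′ ∈ xs ++ ys → b′ ∈ xs ++ b ∷ ys
    widenᴮ b′∈ with ∈-++⁻ xs b′∈
    ... | inj₁ ∈xs = ∈-++⁺ˡ ∈xs
    ... | inj₂ ∈ys = ∈-++⁺ʳ xs (there ∈ys)

    widen : ∀ {x} → x ∈ concat (xs ++ ys) → x ∈ concat (xs ++ b ∷ ys)
    widen x∈ with ∈-concat⁻′ (xs ++ ys) x∈
    ... | b′ , x∈b′ , b′∈ = ∈-concat⁺′ x∈b′ (widenᴮ b′∈)

    removal-count : ∀ x → count x (concat (xs ++ b ∷ ys)) ≡ count x b + count x (concat (xs ++ ys))
    removal-count x = begin
      count x (concat (xs ++ b ∷ ys))       ≡⟨ cong (count x) split ⟩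
      count x (X ++ (b ++ Y))               ≡⟨ count-++ x X (b ++ Y) ⟩
      count x X + count x (b ++ Y)          ≡⟨ cong (count x X +_) (count-++ x b Y) ⟩
      count x X + (count x b + count x Y)   ≡⟨ x∙yz≈y∙xz (count x X) (count x b) (count x Y) ⟩
      count x b + (count x X + count x Y)   ≡⟨ cong (count x b +_) (count-++ x X Y) ⟨
      count x b + count x (X ++ Y)          ≡⟨ cong (λ L → count x b + count x L) merge ⟨
      count x b + count x (concat (xs ++ ys)) ∎
      where open ≡-Reasoning

    b-alone : ∀ {x} → x ∈ b → x ∉ concat (xs ++ ys)
    b-alone {x} x∈b x∈rest = two≰one (begin
      2                                          ≤⟨ +-mono-≤ (∈⇒count-pos b x∈b) (∈⇒count-pos _ x∈rest) ⟩
      count x b + count x (concat (xs ++ ys))    ≡⟨ removal-count x ⟨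
      count x (concat (xs ++ b ∷ ys))            ≡⟨ once (widen x∈rest) ⟩
      1                                          ∎)
      where open ≤-Reasoning
            two≰one : ¬ 2 ≤ 1
            two≰one (s≤s ())

    covers′ : ∀ {x} → x ∈ items → x ∉ c ++ U → x ∈ concat (xs ++ ys)
    covers′ {x} x∈items x∉ with ∈-++⁻ X (subst (x ∈_) split (covers x∈items (x∉ ∘ ∈-++⁺ʳ c)))
    ... | inj₁ x∈X = subst (x ∈_) (sym merge) (∈-++⁺ˡ x∈X)
    ... | inj₂ x∈bY with ∈-++⁻ b x∈bY
    ...   | inj₁ x∈b = contradiction (∈-++⁺ˡ (b⊆c x∈b)) x∉
    ...   | inj₂ x∈Y = subst (x ∈_) (sym merge) (∈-++⁺ʳ X x∈Y)

    fresh′ : ∀ {x} → x ∈ c ++ U → x ∉ concat (xs ++ ys)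
    fresh′ x∈ with ∈-++⁻ c x∈
    ... | inj₁ x∈c = b-alone (c⊆b x∈c)
    ... | inj₂ x∈U = fresh x∈U ∘ widen

    once′ : ∀ {x} → x ∈ concat (xs ++ ys) → count x (concat (xs ++ ys)) ≡ 1
    once′ {x} x∈ = ≤-antisym
      (subst (count x (concat (xs ++ ys)) ≤_) (trans (sym (removal-count x)) (once (widen x∈))) (m≤n+m _ (count x b)))
      (∈⇒count-pos _ x∈)

  mutual
    refutation-sound : ∀ n {U Bs} → Partial U Bs → ¬ Refuted n U
    refutation-sound (suc n) {U} P = refutedAt-sound n P (∈-filter⁻ (_∉? U))

    -- Ts lists uncovered items; the first one, T, lies in some remaining block
    -- b, whose candidate c fits, so the refutation continues below c.
    refutedAt-sound : ∀ n {U Bs Ts} → Partial U Bs →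
                      (∀ {T} → T ∈ Ts → T ∈ items × T ∉ U) → ¬ RefutedAt n U Ts
    refutedAt-sound n {U} {Bs} {T ∷ _} P uncovered r
      with T∈items , T∉U ← uncovered (here refl)
      with b , T∈b , b∈Bs ← ∈-concat⁻′ Bs (Partial.covers P T∈items T∉U)
      with xs , ys , refl ← ∈-∃++ b∈Bs
      with c , c∈ , b⊆c , c⊆b ← Partial.known P b∈Bs
      = refutation-sound n (place xs b ys P b⊆c c⊆b)
          (All.lookup r (∈-filter⁺ (fits? U T) c∈ (b⊆c T∈b , c-avoids-U)))
      where
      c-avoids-U : All (_∉ U) c
      c-avoids-U = All.tabulate λ x∈c x∈U → Partial.fresh P x∈U (∈-concat⁺′ (c⊆b x∈c) b∈Bs)

-- The subsets spanned by three points of Fin v, in lexicographic order (so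
-- the refutation always branches on the least uncovered 3-set).
spans : ∀ v → List (Subset v)
spans v = concatMap (λ a → concatMap (λ b → map (λ c → ⁅ a ⁆ ∪ (⁅ b ⁆ ∪ ⁅ c ⁆)) (allFin v)) (allFin v)) (allFin v)

triples : ∀ v → List (Subset v)
triples v = filter (λ T → ∣ T ∣ ≟ 3) (spans v)

tuples : ∀ v n → List (Vec (Fin v) n)
tuples v zero    = []ᵥ ∷ []
tuples v (suc n) = cartesianProductWith _∷ᵥ_ (allFin v) (tuples v n)

tuples-complete : ∀ {v n} (t : Vec (Fin v) n) → t ∈ tuples v n
tuples-complete []ᵥ       = here refl
tuples-complete (x ∷ᵥ t) = ∈-cartesianProductWith⁺ _∷ᵥ_ (∈-allFin x) (tuples-complete t)

Candidate : ∀ {v} → Vec (Fin v) 5 → Set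
Candidate t = Oriented (lookup t) × (∀ i j → lookup t i ≡ lookup t j → i ≡ j)

candidate? : ∀ {v} → Decidable (Candidate {v})
candidate? t =
  ((lookup t (# 0) ≤ᶠ? lookup t (# 1)) ×-dec (lookup t (# 2) ≤ᶠ? lookup t (# 3))) ×-dec
  allFin? (λ i → allFin? (λ j → (lookup t i ≟ᶠ lookup t j) →-dec (i ≟ᶠ j)))

candidates : ∀ v → List (List (Subset v))
candidates v = map (Edges ∘ lookup) (filter candidate? (tuples v 5))

candidate-of : ∀ {v} (f : Copy v) → Injective _≡_ _≡_ f →
               ∃[ c ] c ∈ candidates v × Edges f ⊆ c × c ⊆ Edges f
candidate-of f inj with orient f inj
... | g , g-inj , g-oriented , g⊆f , f⊆g =
  Edges (lookup t) , ∈-map⁺ (Edges ∘ lookup) (∈-filter⁺ candidate? (tuples-complete t) (g-oriented , t-injective)) ,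
  subst (Edges f ⊆_) same f⊆g , subst (_⊆ Edges f) same g⊆f
  where
  t = tabulate g

  lookup-t : ∀ i → g i ≡ lookup t i
  lookup-t i = sym (lookup∘tabulate g i)

  t-injective : ∀ i j → lookup t i ≡ lookup t j → i ≡ j
  t-injective i j eq = g-inj (trans (lookup-t i) (trans eq (sym (lookup-t j))))

  same : Edges g ≡ Edges (lookup t)
  same = Edges-cong lookup-t

module Cover (v : ℕ) = ExactCover (_≟ₛ_ {v}) (triples v) (candidates v)

module _ (v : ℕ) where
  open Cover v

  decomposition-partial : ((B , _) : S3K4e v) → Partial [] (map Edges B)
  decomposition-partial (B , injective , exactly-once) = record
    { covers = λ T∈ _ → count-pos⇒∈ (allEdges B) (subst (1 ≤_) (sym (exactly-once _ (triple∈ T∈))) ≤-refl)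
    ; fresh  = λ ()
    ; once   = λ e∈ → exactly-once _ (edge-size e∈)
    ; known  = known
    }
    where
    triple∈ : ∀ {T} → T ∈ triples v → ∣ T ∣ ≡ 3
    triple∈ T∈ = proj₂ (∈-filter⁻ (λ T → ∣ T ∣ ≟ 3) {xs = spans v} T∈)

    copy∈ : ∀ {b} → b ∈ map Edges B → ∃[ f ] f ∈ B × b ≡ Edges f
    copy∈ = ∈-map⁻ Edges

    edge-size : ∀ {e} → e ∈ allEdges B → ∣ e ∣ ≡ 3
    edge-size e∈ with ∈-concat⁻′ (map Edges B) e∈
    ... | b , e∈b , b∈ with copy∈ b∈
    ...   | f , f∈ , refl = copy-edge-size (All.lookup injective f∈) e∈b

    known : ∀ {b} → b ∈ map Edges B → ∃[ c ] c ∈ candidates v × b ⊆ c × c ⊆ b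
    known b∈ with copy∈ b∈
    ... | f , f∈ , refl = candidate-of f (All.lookup injective f∈)

  no-decomposition : ∀ n → Refuted n [] → ¬ S3K4e v
  no-decomposition n r d = refutation-sound n (decomposition-partial d) r

-- A decomposition of K₅⁽³⁾ (10 triples) would consist of 2 copies and one of
-- K₆⁽³⁾ (20 triples) of 4; refutation trees of depths 3 and 5 exist.
lemma4p1 : ¬ S3K4e 5 × ¬ S3K4e 6
lemma4p1 = no-decomposition 5 3 (from-yes (Cover.refuted? 5 3 [])) ,
           no-decomposition 6 5 (from-yes (Cover.refuted? 6 5 []))
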